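{- Every instance of \textsc{Monotone NAE 3-SAT} in which each variable appears exactly twice is nae-satisfiable; that is, if $C_1,\dots,C_m$ is a finite list (repetitions allowed) of clauses, each consisting of exactly three distinct unnegated variables from a set $V$, and every variable of $V$ occurs in exactly two of the $C_j$ (counted with multiplicity), then there is a truth assignment $\beta\colon V\to\{T,F\}$ such that every clause $C_j$ contains at least one variable set true and at least one variable set false.
   Context: In \textsc{Monotone NAE 3-SAT}, clauses contain no negated literals and each clause contains exactly three distinct variables; a formula is nae-satisfiable if some truth assignment sets at least one literal true and at least one literal false in each clause. -}

module Defs where

open import Data.Nat using (ℕ; zero; suc; _+_)
open import Data.Fin using (Fin)
open import Data.Fin.Properties using (_≟_)
open import Data.Bool using (Bool; true; false)
open import Data.List using (List; []; _∷_; map)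
open import Data.Nat.ListAction using (sum)
open import Data.Sum using (_⊎_)
open import Data.List.Relation.Unary.All using (All)
open import Data.Product using (_×_; ∃; _,_)
open import Relation.Nullary using (¬_; does)
open import Relation.Binary.PropositionalEquality using (_≡_)

record Clause (n : ℕ) : Set where
  constructor clause
  field
    x y z : Fin n
    x≢y : ¬ x ≡ y
    x≢z : ¬ x ≡ z
    y≢z : ¬ y ≡ z

open Clause public

Formula : ℕ → Set
Formula n = List (Clause n)

[_≟_] : ∀ {n} → Fin n → Fin n → ℕ
[ a ≟ b ] with does (a ≟ b)
... | true = 1
... | false = 0

occC : ∀ {n} → Fin n → Clause n → ℕ
occC v C = [ v ≟ x C ] + ([ v ≟ y C ] + [ v ≟ z C ])

occurrences : ∀ {n} → Fin n → Formula n → ℕ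
occurrences v φ = sum (map (occC v) φ)

NAESat : ∀ {n} → (Fin n → Bool) → Clause n → Set
NAESat β C =
  (β (x C) ≡ true ⊎ (β (y C) ≡ true ⊎ β (z C) ≡ true)) ×
  (β (x C) ≡ false ⊎ (β (y C) ≡ false ⊎ β (z C) ≡ false))

NAESatisfiable : ∀ {n} → Formula n → Set
NAESatisfiable {n} φ = ∃ λ (β : Fin n → Bool) → All (NAESat β) φ

module Submission where

-- We prove the stronger statement for formulas in which every variable
-- occurs AT MOST twice ("bounded"), by strong induction on the number of clauses.
--
-- Let C = {X, Y, Z} be the first clause.  If X occurs in no other clause, solve the rest and
-- set X to the opposite of Y.  Otherwise X occurs in exactly one further clause D = {X, A, B},
-- and X occurs nowhere else.  If C and D share a second variable w, drop both clauses, solve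
-- the rest and set X true, w false.  If not, X can be chosen to nae-satisfy both C and D unless
-- Y = Z ≠ A = B, which any of the equations Y = A, Y = B, Z = A excludes.  We enforce one of
-- them by MERGING the two variables in the remaining formula: Y, Z, A, B occur there at most
-- once, so the merged formula stays bounded.  A merge is only blocked by a clause containing both
-- variables, and if all three pairs were blocked, the unique remaining clauses of Y and of A
-- would coincide and contain Y, A, B and Z, which no 3-clause can.

open import Defs
open import Data.Nat using (ℕ; zero; suc; _+_; _≤_; _<_; z≤n; s≤s)
open import Data.Nat.Properties hiding (_≟_)
open import Data.Fin using (Fin)
open import Data.Fin.Properties using (_≟_)
open import Data.Bool using (Bool; true; false; not)
import Data.Bool.Properties as Bool
open import Data.List using ([]; _∷_; length; map)
open import Data.Nat.ListAction using (sum)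
open import Data.Nat.ListAction.Properties using (sum-↭)
open import Data.List.Relation.Unary.All using (All; []; _∷_)
open import Data.List.Relation.Unary.All.Properties using (¬Any⇒All¬)
open import Data.List.Relation.Unary.Any using (Any; here; there; any?)
import Data.List.Relation.Unary.Any as Any
open import Data.List.Relation.Binary.Permutation.Propositional
  using (_↭_; prep; swap; ↭-sym; ↭-refl; ↭-trans)
open import Data.List.Relation.Binary.Permutation.Propositional.Properties
  using (All-resp-↭; map⁺; ↭-length)
open import Data.Vec.Functional using (updateAt)
open import Data.Vec.Functional.Properties using (updateAt-updates; updateAt-minimal)
open import Data.Product using (_×_; _,_; ∃; ∃₂; proj₁)
open import Data.Sum using (_⊎_; inj₁; inj₂; [_,_])
open import Data.Empty using (⊥; ⊥-elim)
open import Function using (_∘_; const)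
open import Relation.Nullary using (¬_; Dec; yes; no)
open import Relation.Nullary.Decidable using (_×-dec_; dec-true; dec-false)
open import Relation.Binary.PropositionalEquality
  using (_≡_; _≢_; refl; sym; trans; cong; cong₂; subst; module ≡-Reasoning)
open import Algebra.Properties.CommutativeSemigroup +-commutativeSemigroup using (interchange)

noThreeInTwo : ∀ {A : Set} {u w a b c : A} →
  a ≡ u ⊎ a ≡ w → b ≡ u ⊎ b ≡ w → c ≡ u ⊎ c ≡ w → a ≢ b → a ≢ c → b ≢ c → ⊥
noThreeInTwo (inj₁ refl) (inj₁ refl) _           a≢b _   _   = a≢b refl
noThreeInTwo (inj₂ refl) (inj₂ refl) _           a≢b _   _   = a≢b refl
noThreeInTwo (inj₁ refl) (inj₂ refl) (inj₁ refl) _   a≢c _   = a≢c refl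
noThreeInTwo (inj₁ refl) (inj₂ refl) (inj₂ refl) _   _   b≢c = b≢c refl
noThreeInTwo (inj₂ refl) (inj₁ refl) (inj₁ refl) _   _   b≢c = b≢c refl
noThreeInTwo (inj₂ refl) (inj₁ refl) (inj₂ refl) _   a≢c _   = a≢c refl

OneOf : Bool → Bool → Bool → Bool → Set
OneOf t a b c = a ≡ t ⊎ b ≡ t ⊎ c ≡ t

NAE3 : Bool → Bool → Bool → Set
NAE3 a b c = OneOf true a b c × OneOf false a b c

NAE3-cong : ∀ {a a′ b b′ c c′} → a ≡ a′ → b ≡ b′ → c ≡ c′ → NAE3 a b c → NAE3 a′ b′ c′
NAE3-cong refl refl refl h = h

nae-not : ∀ b c → NAE3 (not b) b c
nae-not true  c = inj₂ (inj₁ refl) , inj₁ refl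
nae-not false c = inj₁ refl , inj₂ (inj₁ refl)

nae-distinct : ∀ a {b c} → b ≢ c → NAE3 a b c
nae-distinct a {true}  {false} _   = inj₂ (inj₁ refl) , inj₂ (inj₂ refl)
nae-distinct a {false} {true}  _   = inj₂ (inj₂ refl) , inj₂ (inj₁ refl)
nae-distinct a {true}  {true}  b≢c = ⊥-elim (b≢c refl)
nae-distinct a {false} {false} b≢c = ⊥-elim (b≢c refl)

-- The value of a shared variable X can make both {X, Y, Z} and {X, A, B} not-all-equal,
-- unless Y = Z ≠ A = B; any of the equations Y = A, Y = B, Z = A rules that out.
chooseShared : ∀ yv zv av bv → yv ≡ av ⊎ yv ≡ bv ⊎ zv ≡ av →
  ∃ λ t → NAE3 t yv zv × NAE3 t av bv
chooseShared yv zv av bv linked with yv Bool.≟ zv | av Bool.≟ bv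
... | no y≢z  | _        = not av , nae-distinct (not av) y≢z , nae-not av bv
... | yes _   | no a≢b   = not yv , nae-not yv zv , nae-distinct (not yv) a≢b
... | yes y≡z | yes a≡b  =
  not yv , nae-not yv zv , subst (λ t → NAE3 (not t) av bv) (sym y≡a) (nae-not av bv)
  where
  y≡a : yv ≡ av
  y≡a = [ (λ e → e) , [ (λ e → trans e (sym a≡b)) , trans y≡z ] ] linked

module _ {n : ℕ} where

  infix 4 _∈C_ _∈C?_

  data _∈C_ (v : Fin n) (E : Clause n) : Set where
    at-x : v ≡ x E → v ∈C E
    at-y : v ≡ y E → v ∈C E
    at-z : v ≡ z E → v ∈C E

  _∈C?_ : (v : Fin n) (E : Clause n) → Dec (v ∈C E)
  v ∈C? E with v ≟ x E | v ≟ y E | v ≟ z E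
  ... | yes e | _     | _     = yes (at-x e)
  ... | no _  | yes e | _     = yes (at-y e)
  ... | no _  | no _  | yes e = yes (at-z e)
  ... | no ¬x | no ¬y | no ¬z = no λ { (at-x e) → ¬x e ; (at-y e) → ¬y e ; (at-z e) → ¬z e }

  ∉⇒≢ : ∀ {u v E} → ¬ v ∈C E → u ∈C E → v ≢ u
  ∉⇒≢ v∉E u∈E refl = v∉E u∈E

  record Pivot (p : Fin n) (E : Clause n) : Set where
    field
      u w   : Fin n
      p∈    : p ∈C E
      u∈    : u ∈C E
      w∈    : w ∈C E
      p≢u   : p ≢ u
      p≢w   : p ≢ w
      u≢w   : u ≢ w
      cover : ∀ {v} → v ∈C E → v ≡ p ⊎ v ≡ u ⊎ v ≡ w

  pivot : ∀ {p E} → p ∈C E → Pivot p E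
  pivot {E = clause x y z x≢y x≢z y≢z} (at-x refl) = record
    { p∈ = at-x refl ; u = y ; w = z ; u∈ = at-y refl ; w∈ = at-z refl
    ; p≢u = x≢y ; p≢w = x≢z ; u≢w = y≢z
    ; cover = λ { (at-x e) → inj₁ e ; (at-y e) → inj₂ (inj₁ e) ; (at-z e) → inj₂ (inj₂ e) } }
  pivot {E = clause x y z x≢y x≢z y≢z} (at-y refl) = record
    { p∈ = at-y refl ; u = x ; w = z ; u∈ = at-x refl ; w∈ = at-z refl
    ; p≢u = x≢y ∘ sym ; p≢w = y≢z ; u≢w = x≢z
    ; cover = λ { (at-x e) → inj₂ (inj₁ e) ; (at-y e) → inj₁ e ; (at-z e) → inj₂ (inj₂ e) } }
  pivot {E = clause x y z x≢y x≢z y≢z} (at-z refl) = record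
    { p∈ = at-z refl ; u = x ; w = y ; u∈ = at-x refl ; w∈ = at-y refl
    ; p≢u = x≢z ∘ sym ; p≢w = y≢z ∘ sym ; u≢w = x≢y
    ; cover = λ { (at-x e) → inj₂ (inj₁ e) ; (at-y e) → inj₂ (inj₂ e) ; (at-z e) → inj₁ e } }

  noFourMembers : ∀ {E p a b c} → p ∈C E → a ∈C E → b ∈C E → c ∈C E →
    p ≢ a → p ≢ b → p ≢ c → a ≢ b → a ≢ c → b ≢ c → ⊥
  noFourMembers {E} {p} p∈ a∈ b∈ c∈ p≢a p≢b p≢c =
    noThreeInTwo (other a∈ p≢a) (other b∈ p≢b) (other c∈ p≢c)
    where
    open Pivot (pivot p∈)
    other : ∀ {v} → v ∈C E → p ≢ v → v ≡ u ⊎ v ≡ w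
    other m p≢v with cover m
    ... | inj₁ refl = ⊥-elim (p≢v refl)
    ... | inj₂ r = r

  Takes : (Fin n → Bool) → Bool → Clause n → Set
  Takes β t E = ∃ λ v → v ∈C E × β v ≡ t

  takes⇒oneOf : ∀ {β t E} → Takes β t E → OneOf t (β (x E)) (β (y E)) (β (z E))
  takes⇒oneOf (_ , at-x refl , e) = inj₁ e
  takes⇒oneOf (_ , at-y refl , e) = inj₂ (inj₁ e)
  takes⇒oneOf (_ , at-z refl , e) = inj₂ (inj₂ e)

  oneOf⇒takes : ∀ {β t E} → OneOf t (β (x E)) (β (y E)) (β (z E)) → Takes β t E
  oneOf⇒takes {E = E} (inj₁ e)        = x E , at-x refl , e
  oneOf⇒takes {E = E} (inj₂ (inj₁ e)) = y E , at-y refl , e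
  oneOf⇒takes {E = E} (inj₂ (inj₂ e)) = z E , at-z refl , e

  witnessesSat : ∀ {β E} → Takes β true E → Takes β false E → NAESat β E
  witnessesSat t f = takes⇒oneOf t , takes⇒oneOf f

  agreeSat : ∀ {β β′ E} → (∀ {v} → v ∈C E → β v ≡ β′ v) → NAESat β E → NAESat β′ E
  agreeSat {β} {β′} {E} agree (t , f) =
    witnessesSat (transfer (oneOf⇒takes t)) (transfer (oneOf⇒takes f))
    where
    transfer : ∀ {b} → Takes β b E → Takes β′ b E
    transfer (v , m , e) = v , m , trans (sym (agree m)) e

  pivotSat : ∀ {β p E} (P : Pivot p E) →
    NAE3 (β p) (β (Pivot.u P)) (β (Pivot.w P)) → NAESat β E
  pivotSat {β} {p} {E} P (t , f) = witnessesSat (pick t) (pick f)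
    where
    open Pivot P
    pick : ∀ {b} → OneOf b (β p) (β u) (β w) → Takes β b E
    pick (inj₁ e)        = p , p∈ , e
    pick (inj₂ (inj₁ e)) = u , u∈ , e
    pick (inj₂ (inj₂ e)) = w , w∈ , e

  reassign : (Fin n → Bool) → Fin n → Bool → Fin n → Bool
  reassign β p b = updateAt β p (const b)

  reassign-self : ∀ β p b → reassign β p b p ≡ b
  reassign-self β p b = updateAt-updates p β

  reassign-other : ∀ β {p} b {v} → v ≢ p → reassign β p b v ≡ β v
  reassign-other β {p} b {v} v≢p = updateAt-minimal v p β v≢p

  reassign-absent : ∀ {β p} b (φ : Formula n) → All (λ E → ¬ p ∈C E) φ →
    All (NAESat β) φ → All (NAESat (reassign β p b)) φ
  reassign-absent b [] [] [] = []
  reassign-absent {β} {p} b (E ∷ φ) (p∉E ∷ p∉φ) (sat ∷ sats) =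
    agreeSat {β} {reassign β p b} {E} (λ v∈E → sym (reassign-other β b (∉⇒≢ p∉E v∈E ∘ sym))) sat
    ∷ reassign-absent b φ p∉φ sats

  indicator-≡ : ∀ {a b : Fin n} → a ≡ b → [ a ≟ b ] ≡ 1
  indicator-≡ {a} {b} a≡b rewrite dec-true (a ≟ b) a≡b = refl

  indicator-≢ : ∀ {a b : Fin n} → a ≢ b → [ a ≟ b ] ≡ 0
  indicator-≢ {a} {b} a≢b rewrite dec-false (a ≟ b) a≢b = refl

  ∈⇒occ : ∀ {v E} → v ∈C E → 1 ≤ occC v E
  ∈⇒occ (at-x e) = ≤-trans (≤-reflexive (sym (indicator-≡ e))) (m≤m+n _ _)
  ∈⇒occ {v} {E} (at-y e) =
    ≤-trans (≤-trans (≤-reflexive (sym (indicator-≡ e))) (m≤m+n _ _)) (m≤n+m _ [ v ≟ x E ])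
  ∈⇒occ {v} {E} (at-z e) =
    ≤-trans (≤-trans (≤-reflexive (sym (indicator-≡ e))) (m≤n+m _ _)) (m≤n+m _ [ v ≟ x E ])

  occ-tail : ∀ {k} v E (φ : Formula n) → occurrences v (E ∷ φ) ≤ k → occurrences v φ ≤ k
  occ-tail v E φ = ≤-trans (m≤n+m _ (occC v E))

  occ-drop : ∀ {v E k} (φ : Formula n) → v ∈C E →
    occurrences v (E ∷ φ) ≤ suc k → occurrences v φ ≤ k
  occ-drop {v} φ v∈E h = ≤-pred (≤-trans (+-monoˡ-≤ (occurrences v φ) (∈⇒occ v∈E)) h)

  ∈⇒occurs : ∀ {v} (φ : Formula n) → Any (v ∈C_) φ → 1 ≤ occurrences v φ
  ∈⇒occurs {v} (E ∷ φ) (here v∈E) = ≤-trans (∈⇒occ v∈E) (m≤m+n (occC v E) _)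
  ∈⇒occurs {v} (E ∷ φ) (there a)  = ≤-trans (∈⇒occurs φ a) (m≤n+m _ (occC v E))

  absent : ∀ {v} (φ : Formula n) → occurrences v φ ≤ 0 → All (λ E → ¬ v ∈C E) φ
  absent φ h = ¬Any⇒All¬ φ (λ a → 1+n≰n (≤-trans (∈⇒occurs φ a) h))

  -- A variable occurring at most once lies in at most one clause: two clauses containing it,
  -- with properties P and Q, are one clause with both properties.
  sameClause : ∀ {v} {P Q : Clause n → Set} (φ : Formula n) → occurrences v φ ≤ 1 →
    Any (λ E → v ∈C E × P E) φ → Any (λ E → v ∈C E × Q E) φ → Any (λ E → v ∈C E × P E × Q E) φ
  sameClause (E ∷ φ) h (here (v∈E , p)) (here (_ , q)) = here (v∈E , p , q)
  sameClause (E ∷ φ) h (here (v∈E , _)) (there a)      =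
    ⊥-elim (1+n≰n (≤-trans (∈⇒occurs φ (Any.map proj₁ a)) (occ-drop φ v∈E h)))
  sameClause (E ∷ φ) h (there a)        (here (v∈E , _)) =
    ⊥-elim (1+n≰n (≤-trans (∈⇒occurs φ (Any.map proj₁ a)) (occ-drop φ v∈E h)))
  sameClause {v} (E ∷ φ) h (there a)        (there b)        =
    there (sameClause φ (occ-tail v E φ h) a b)

  occurrences-↭ : ∀ {φ ψ : Formula n} → φ ↭ ψ → ∀ v → occurrences v φ ≡ occurrences v ψ
  occurrences-↭ φ↭ψ v = sum-↭ (map⁺ (occC v) φ↭ψ)

  satisfiable-↭ : ∀ {φ ψ : Formula n} → φ ↭ ψ → NAESatisfiable ψ → NAESatisfiable φ
  satisfiable-↭ φ↭ψ (β , sats) = β , All-resp-↭ (↭-sym φ↭ψ) sats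

  extract : ∀ {P : Clause n → Set} {φ} → Any P φ → ∃₂ λ D rest → P D × φ ↭ D ∷ rest
  extract (here {x = D} pD) = D , _ , pD , ↭-refl
  extract (there {x = E} a) with D , rest , pD , φ↭ ← extract a =
    D , E ∷ rest , pD , ↭-trans (prep E φ↭) (swap E D ↭-refl)

  -- Weighting the three variable slots of every clause by g; occurrences v φ is the weight of
  -- the indicator of v.
  slotSum : (Fin n → ℕ) → Clause n → ℕ
  slotSum g E = g (x E) + (g (y E) + g (z E))

  weight : (Fin n → ℕ) → Formula n → ℕ
  weight g φ = sum (map (slotSum g) φ)

  weight-mono : ∀ {g h} (φ : Formula n) → (∀ e → g e ≤ h e) → weight g φ ≤ weight h φ
  weight-mono []      g≤h = z≤n
  weight-mono (E ∷ φ) g≤h =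
    +-mono-≤ (+-mono-≤ (g≤h (x E)) (+-mono-≤ (g≤h (y E)) (g≤h (z E)))) (weight-mono φ g≤h)

  weight-+ : ∀ g h (φ : Formula n) → weight (λ e → g e + h e) φ ≡ weight g φ + weight h φ
  weight-+ g h []      = refl
  weight-+ g h (E ∷ φ) = begin
    slotSum (λ e → g e + h e) E + weight (λ e → g e + h e) φ
      ≡⟨ cong₂ _+_ slots (weight-+ g h φ) ⟩
    (slotSum g E + slotSum h E) + (weight g φ + weight h φ)
      ≡⟨ interchange (slotSum g E) (slotSum h E) (weight g φ) (weight h φ) ⟩
    weight g (E ∷ φ) + weight h (E ∷ φ) ∎
    where
    open ≡-Reasoning
    slots : slotSum (λ e → g e + h e) E ≡ slotSum g E + slotSum h E
    slots = trans (cong (g (x E) + h (x E) +_)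
                        (interchange (g (y E)) (h (y E)) (g (z E)) (h (z E))))
                  (interchange (g (x E)) (h (x E)) _ _)

  merge : Fin n → Fin n → Fin n → Fin n
  merge q p v with v ≟ q
  ... | yes _ = p
  ... | no  _ = v

  -- p and q can be identified in E without collapsing two of its variables.
  Mergeable : Fin n → Fin n → Clause n → Set
  Mergeable p q E = ¬ (p ∈C E × q ∈C E)

  mergeable? : (p q : Fin n) (φ : Formula n) →
    All (Mergeable p q) φ ⊎ Any (λ E → p ∈C E × q ∈C E) φ
  mergeable? p q φ with any? (λ E → (p ∈C? E) ×-dec (q ∈C? E)) φ
  ... | yes together = inj₂ together
  ... | no  never    = inj₁ (¬Any⇒All¬ φ never)

  merge-distinct : ∀ {p q E e₁ e₂} → Mergeable p q E → e₁ ∈C E → e₂ ∈C E → e₁ ≢ e₂ →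
    merge q p e₁ ≢ merge q p e₂
  merge-distinct {q = q} {e₁ = e₁} {e₂} ok e₁∈ e₂∈ e₁≢e₂ with e₁ ≟ q | e₂ ≟ q
  ... | yes refl | yes refl = λ _ → e₁≢e₂ refl
  ... | yes refl | no  _    = λ { refl → ok (e₂∈ , e₁∈) }
  ... | no  _    | yes refl = λ { refl → ok (e₁∈ , e₂∈) }
  ... | no  _    | no  _    = e₁≢e₂

  mergeClause : ∀ {p q} (E : Clause n) → Mergeable p q E → Clause n
  mergeClause {p} {q} E ok = clause (merge q p (x E)) (merge q p (y E)) (merge q p (z E))
    (merge-distinct ok (at-x refl) (at-y refl) (x≢y E))
    (merge-distinct ok (at-x refl) (at-z refl) (x≢z E))
    (merge-distinct ok (at-y refl) (at-z refl) (y≢z E))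

  mergeFormula : ∀ {p q} (φ : Formula n) → All (Mergeable p q) φ → Formula n
  mergeFormula []      []         = []
  mergeFormula (E ∷ φ) (ok ∷ oks) = mergeClause E ok ∷ mergeFormula φ oks

  mergeFormula-length : ∀ {p q} (φ : Formula n) (oks : All (Mergeable p q) φ) →
    length (mergeFormula φ oks) ≡ length φ
  mergeFormula-length []      []         = refl
  mergeFormula-length (E ∷ φ) (ok ∷ oks) = cong suc (mergeFormula-length φ oks)

  mergeFormula-sat : ∀ {p q β} (φ : Formula n) (oks : All (Mergeable p q) φ) →
    All (NAESat β) (mergeFormula φ oks) → All (NAESat (β ∘ merge q p)) φ
  mergeFormula-sat []      []         []           = []
  mergeFormula-sat (E ∷ φ) (ok ∷ oks) (sat ∷ sats) = sat ∷ mergeFormula-sat φ oks sats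

  mergeFormula-weight : ∀ {p q} g (φ : Formula n) (oks : All (Mergeable p q) φ) →
    weight g (mergeFormula φ oks) ≡ weight (g ∘ merge q p) φ
  mergeFormula-weight g []      []         = refl
  mergeFormula-weight {p} {q} g (E ∷ φ) (ok ∷ oks) =
    cong (slotSum (g ∘ merge q p) E +_) (mergeFormula-weight g φ oks)

  merge-other-indicator : ∀ {p q v} e → v ≢ p → [ v ≟ merge q p e ] ≤ [ v ≟ e ]
  merge-other-indicator {q = q} e v≢p with e ≟ q
  ... | yes _ = ≤-trans (≤-reflexive (indicator-≢ v≢p)) z≤n
  ... | no  _ = ≤-refl

  merge-target-indicator : ∀ {p q} e → [ p ≟ merge q p e ] ≤ [ p ≟ e ] + [ q ≟ e ]
  merge-target-indicator {p} {q} e with e ≟ q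
  ... | yes refl = ≤-trans (≤-reflexive (trans (indicator-≡ {p} refl) (sym (indicator-≡ {q} refl))))
                           (m≤n+m [ q ≟ q ] [ p ≟ q ])
  ... | no  _    = m≤m+n _ _

  occ-merge-other : ∀ {p q v} (φ : Formula n) (oks : All (Mergeable p q) φ) → v ≢ p →
    occurrences v (mergeFormula φ oks) ≤ occurrences v φ
  occ-merge-other {p} {q} {v} φ oks v≢p = begin
    occurrences v (mergeFormula φ oks)  ≡⟨ mergeFormula-weight (λ e → [ v ≟ e ]) φ oks ⟩
    weight (λ e → [ v ≟ merge q p e ]) φ
      ≤⟨ weight-mono φ (λ e → merge-other-indicator {q = q} e v≢p) ⟩
    occurrences v φ                     ∎
    where open ≤-Reasoning

  occ-merge-target : ∀ {p q} (φ : Formula n) (oks : All (Mergeable p q) φ) →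
    occurrences p (mergeFormula φ oks) ≤ occurrences p φ + occurrences q φ
  occ-merge-target {p} {q} φ oks = begin
    occurrences p (mergeFormula φ oks)          ≡⟨ mergeFormula-weight (λ e → [ p ≟ e ]) φ oks ⟩
    weight (λ e → [ p ≟ merge q p e ]) φ        ≤⟨ weight-mono φ (merge-target-indicator {p} {q}) ⟩
    weight (λ e → [ p ≟ e ] + [ q ≟ e ]) φ      ≡⟨ weight-+ (λ e → [ p ≟ e ]) (λ e → [ q ≟ e ]) φ ⟩
    occurrences p φ + occurrences q φ           ∎
    where open ≤-Reasoning

  merge-identifies : ∀ p q → merge q p p ≡ merge q p q
  merge-identifies p q with p ≟ q | q ≟ q
  ... | _     | no q≢q = ⊥-elim (q≢q refl)
  ... | yes _ | yes _  = refl
  ... | no  _ | yes _  = refl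

  Bounded : Formula n → Set
  Bounded φ = ∀ v → occurrences v φ ≤ 2

  Solvable : ℕ → Set
  Solvable k = ∀ ψ → length ψ < k → Bounded ψ → NAESatisfiable ψ

  merge-bounded : ∀ {p q} (φ : Formula n) (oks : All (Mergeable p q) φ) → Bounded φ →
    occurrences p φ ≤ 1 → occurrences q φ ≤ 1 → Bounded (mergeFormula φ oks)
  merge-bounded {p} φ oks bounded p-once q-once v with v ≟ p
  ... | yes refl = ≤-trans (occ-merge-target φ oks) (+-mono-≤ p-once q-once)
  ... | no  v≢p  = ≤-trans (occ-merge-other φ oks v≢p) (bounded v)

  -- Two variables occurring at most once each and never in a common clause can be forced
  -- to take equal values: merge q into p, solve the (shorter-or-equal) result, and pull back.
  forceEqual : ∀ {k p q} (φ : Formula n) → Solvable k → length φ < k → Bounded φ →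
    occurrences p φ ≤ 1 → occurrences q φ ≤ 1 → All (Mergeable p q) φ →
    ∃ λ β → All (NAESat β) φ × β p ≡ β q
  forceEqual {p = p} {q} φ solve short bounded p-once q-once oks
    with β , sats ← solve (mergeFormula φ oks)
                          (subst (_< _) (sym (mergeFormula-length φ oks)) short)
                          (merge-bounded φ oks bounded p-once q-once)
    = β ∘ merge q p , mergeFormula-sat φ oks sats , cong β (merge-identifies p q)

  -- A clause whose first variable occurs in no other clause can be added to any
  -- nae-satisfiable formula: give that variable the opposite value of the second one.
  lonelyClause : ∀ (C : Clause n) φ → All (λ E → ¬ x C ∈C E) φ →
    NAESatisfiable φ → NAESatisfiable (C ∷ φ)
  lonelyClause C φ X∉φ (β , sats) = β′ , satC ∷ reassign-absent t φ X∉φ sats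
    where
    t  = not (β (y C))
    β′ = reassign β (x C) t
    satC : NAESat β′ C
    satC = NAE3-cong (sym (reassign-self β (x C) t))
                     (sym (reassign-other β t (x≢y C ∘ sym)))
                     (sym (reassign-other β t (x≢z C ∘ sym)))
                     (nae-not (β (y C)) (β (z C)))

  -- The main case: C = {X, Y, Z} and D = {X, A, B} share X, and the formula C ∷ D ∷ rest
  -- is bounded, so X does not occur in rest and every other variable of C or D at most once.
  module TwoClauses {k} (solve : Solvable k) (C D : Clause n) (rest : Formula n)
                    (short : length rest < k) (bounded : Bounded (C ∷ D ∷ rest))
                    (X∈D : x C ∈C D) where

    X Y Z : Fin n
    X = x C
    Y = y C
    Z = z C

    open Pivot (pivot X∈D) using () renaming
      (u to A; w to B; u∈ to A∈D; w∈ to B∈D; p≢u to X≢A; p≢w to X≢B; u≢w to A≢B)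

    rest-bounded : Bounded rest
    rest-bounded v = occ-tail v D rest (occ-tail v C (D ∷ rest) (bounded v))

    onceC : ∀ {v} → v ∈C C → occurrences v rest ≤ 1
    onceC {v} v∈C = occ-tail v D rest (occ-drop (D ∷ rest) v∈C (bounded v))

    onceD : ∀ {v} → v ∈C D → occurrences v rest ≤ 1
    onceD {v} v∈D = occ-drop rest v∈D (occ-tail v C (D ∷ rest) (bounded v))

    absentC∩D : ∀ {v} → v ∈C C → v ∈C D → All (λ E → ¬ v ∈C E) rest
    absentC∩D {v} v∈C v∈D = absent rest (occ-drop rest v∈D (occ-drop (D ∷ rest) v∈C (bounded v)))

    -- If C and D share a second variable w, make X true and w false.
    shareTwo : ∀ {w} → w ∈C C → w ∈C D → w ≢ X → NAESatisfiable (C ∷ D ∷ rest)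
    shareTwo {w} w∈C w∈D w≢X with β , sats ← solve rest short rest-bounded =
      β″ , naeBy C (at-x refl) w∈C ∷ naeBy D X∈D w∈D
         ∷ reassign-absent false rest (absentC∩D w∈C w∈D)
             (reassign-absent true rest (absentC∩D (at-x refl) X∈D) sats)
      where
      β′ β″ : Fin n → Bool
      β′ = reassign β X true
      β″ = reassign β′ w false
      naeBy : ∀ E → X ∈C E → w ∈C E → NAESat β″ E
      naeBy E X∈E w∈E = witnessesSat
        (X , X∈E , trans (reassign-other β′ false (w≢X ∘ sym)) (reassign-self β X true))
        (w , w∈E , reassign-self β′ w false)

    extendByX : ∀ {β} → All (NAESat β) rest → ∀ t →
      NAE3 t (β Y) (β Z) → NAE3 t (β A) (β B) → NAESatisfiable (C ∷ D ∷ rest)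
    extendByX {β} sats t naeC naeD =
      β′ , satC ∷ satD ∷ reassign-absent t rest (absentC∩D (at-x refl) X∈D) sats
      where
      β′ : Fin n → Bool
      β′ = reassign β X t
      satC : NAESat β′ C
      satC = NAE3-cong (sym (reassign-self β X t)) (sym (reassign-other β t (x≢y C ∘ sym)))
                       (sym (reassign-other β t (x≢z C ∘ sym))) naeC
      satD : NAESat β′ D
      satD = pivotSat (pivot X∈D)
        (NAE3-cong (sym (reassign-self β X t)) (sym (reassign-other β t (X≢A ∘ sym)))
                   (sym (reassign-other β t (X≢B ∘ sym))) naeD)

    module Disjoint (Y∉D : ¬ Y ∈C D) (Z∉D : ¬ Z ∈C D) where

      -- Forcing β p = β q for p ∈ C, q ∈ D, where this equation implies one of Y = A, Y = B,
      -- Z = A, lets chooseShared find the value of X.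
      viaMerge : ∀ {p q} → p ∈C C → q ∈C D → All (Mergeable p q) rest →
        (∀ {β : Fin n → Bool} → β p ≡ β q → β Y ≡ β A ⊎ β Y ≡ β B ⊎ β Z ≡ β A) →
        NAESatisfiable (C ∷ D ∷ rest)
      viaMerge p∈C q∈D oks link
        with β , sats , p≡q ← forceEqual rest solve short rest-bounded (onceC p∈C) (onceD q∈D) oks
        with t , naeC , naeD ← chooseShared (β Y) (β Z) (β A) (β B) (link p≡q)
        = extendByX sats t naeC naeD

      -- The pairs (Y, A), (Y, B), (Z, A) cannot all share a clause of rest: since Y and A occur
      -- at most once there, these would all be one clause containing Y, A, B and Z.
      notAllLinked : Any (λ E → Y ∈C E × A ∈C E) rest → Any (λ E → Y ∈C E × B ∈C E) rest →
        Any (λ E → Z ∈C E × A ∈C E) rest → ⊥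
      notAllLinked YA YB ZA
        with _ , A∈E , (Y∈E , B∈E) , Z∈E ←
          Any.satisfied (sameClause rest (onceD A∈D)
            (Any.map (λ (Y∈ , A∈ , B∈) → A∈ , Y∈ , B∈) (sameClause rest (onceC (at-y refl)) YA YB))
            (Any.map (λ (Z∈ , A∈) → A∈ , Z∈) ZA))
        = noFourMembers A∈E Y∈E B∈E Z∈E
            (∉⇒≢ Y∉D A∈D ∘ sym) A≢B (∉⇒≢ Z∉D A∈D ∘ sym) (∉⇒≢ Y∉D B∈D) (y≢z C) (∉⇒≢ Z∉D B∈D ∘ sym)

      result : NAESatisfiable (C ∷ D ∷ rest)
      result with mergeable? Y A rest
      ... | inj₁ oks = viaMerge (at-y refl) A∈D oks inj₁
      ... | inj₂ YA with mergeable? Y B rest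
      ...   | inj₁ oks = viaMerge (at-y refl) B∈D oks (inj₂ ∘ inj₁)
      ...   | inj₂ YB with mergeable? Z A rest
      ...     | inj₁ oks = viaMerge (at-z refl) A∈D oks (inj₂ ∘ inj₂)
      ...     | inj₂ ZA = ⊥-elim (notAllLinked YA YB ZA)

    result : NAESatisfiable (C ∷ D ∷ rest)
    result with Y ∈C? D | Z ∈C? D
    ... | yes Y∈D | _       = shareTwo (at-y refl) Y∈D (x≢y C ∘ sym)
    ... | no  _   | yes Z∈D = shareTwo (at-z refl) Z∈D (x≢z C ∘ sym)
    ... | no  Y∉D | no  Z∉D = Disjoint.result Y∉D Z∉D

  step : ∀ {k} → Solvable k → Solvable (suc k)
  step solve []      _           _       = (λ _ → true) , []
  step solve (C ∷ φ) (s≤s short) bounded with any? (x C ∈C?_) φ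
  ... | no X∉φ =
    lonelyClause C φ (¬Any⇒All¬ φ X∉φ) (solve φ short (λ v → occ-tail v C φ (bounded v)))
  ... | yes X∈φ with D , rest , X∈D , φ↭ ← extract X∈φ =
    satisfiable-↭ C∷φ↭ (TwoClauses.result solve C D rest rest-short bounded′ X∈D)
    where
    C∷φ↭ : C ∷ φ ↭ C ∷ D ∷ rest
    C∷φ↭ = prep C φ↭
    rest-short : length rest < _
    rest-short = <-trans (≤-reflexive (sym (↭-length φ↭))) short
    bounded′ : Bounded (C ∷ D ∷ rest)
    bounded′ v = subst (_≤ 2) (occurrences-↭ C∷φ↭ v) (bounded v)

  solvable : ∀ k → Solvable k
  solvable zero    _ ()
  solvable (suc k) = step (solvable k)

  boundedSatisfiable : (φ : Formula n) → Bounded φ → NAESatisfiable φ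
  boundedSatisfiable φ = solvable (suc (length φ)) φ (n<1+n (length φ))

mainTheorem4 : (n : ℕ) (φ : Formula n) →
    ((v : Fin n) → occurrences v φ ≡ 2) →
    NAESatisfiable φ
mainTheorem4 n φ twice = boundedSatisfiable φ (λ v → ≤-reflexive (twice v))
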